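{- Let $A$ be a strongly computable finite factorization domain (SCFFD) equipped with divisor function $D$. Then: (1) the set $U(A)$ of units of $A$ is a finite set that can be computed from $A$; (2) the set of irreducible elements of $A$ is computable.
   Context: A computable ring is a ring whose underlying set is a computable set $A \subseteq \mathbb{N}$ with addition and multiplication computable functions $A\times A \to A$. A strongly computable finite factorization domain (SCFFD) is a computable integral domain $A$ equipped with a computable function $D$ such that for every nonzero $a \in A$, $D(a)$ is a canonical index for the finite set of all divisors of $a$ in $A$ (so in particular every nonzero element has only finitely many divisors). -}

module Defs where

open import Data.Nat using (ℕ)
open import Data.Bool using (Bool; true)
open import Data.Product using (Σ; _×_; ∃)
open import Data.Sum using (_⊎_)
open import Data.List using (List)
open import Data.List.Membership.Propositional using (_∈_)
open import Relation.Binary.PropositionalEquality using (_≡_)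
open import Relation.Nullary using (¬_)
open import Function.Bundles using (_⇔_)

-- A computable ring: the carrier is a computable (decidable) subset A ⊆ ℕ,
-- given by its characteristic function 'mem'; addition and multiplication
-- are (computable, i.e. Agda-definable) functions mapping A × A into A.
-- Equality of ring elements is equality of natural numbers.
record ComputableIntegralDomain : Set where
  field
    mem  : ℕ → Bool
    add  : ℕ → ℕ → ℕ
    mul  : ℕ → ℕ → ℕ
    zro  : ℕ
    one  : ℕ
    neg  : ℕ → ℕ

  InA : ℕ → Set
  InA n = mem n ≡ true

  field
    add-closed : ∀ {a b} → InA a → InA b → InA (add a b)
    mul-closed : ∀ {a b} → InA a → InA b → InA (mul a b)
    neg-closed : ∀ {a} → InA a → InA (neg a)
    zro-in     : InA zro
    one-in     : InA one
    add-assoc  : ∀ {a b c} → InA a → InA b → InA c → add (add a b) c ≡ add a (add b c)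
    add-comm   : ∀ {a b} → InA a → InA b → add a b ≡ add b a
    add-idˡ    : ∀ {a} → InA a → add zro a ≡ a
    add-invˡ   : ∀ {a} → InA a → add (neg a) a ≡ zro
    mul-assoc  : ∀ {a b c} → InA a → InA b → InA c → mul (mul a b) c ≡ mul a (mul b c)
    mul-comm   : ∀ {a b} → InA a → InA b → mul a b ≡ mul b a
    mul-idˡ    : ∀ {a} → InA a → mul one a ≡ a
    distribˡ   : ∀ {a b c} → InA a → InA b → InA c → mul a (add b c) ≡ add (mul a b) (mul a c)
    one≢zro    : ¬ (one ≡ zro)
    no-zero-div : ∀ {a b} → InA a → InA b → mul a b ≡ zro → (a ≡ zro) ⊎ (b ≡ zro)

  _∣A_ : ℕ → ℕ → Set
  d ∣A a = Σ ℕ λ c → InA c × (mul d c ≡ a)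

  IsUnit : ℕ → Set
  IsUnit u = InA u × (Σ ℕ λ v → InA v × (mul u v ≡ one))

  Irreducible : ℕ → Set
  Irreducible x = InA x × ¬ (x ≡ zro) × ¬ IsUnit x
                  × (∀ a b → InA a → InA b → mul a b ≡ x → IsUnit a ⊎ IsUnit b)

-- A strongly computable finite factorization domain: a computable integral
-- domain with a computable function D such that, for each nonzero a ∈ A,
-- D a is a (canonical code, here: a finite list for) the set of all
-- divisors of a in A.
record SCFFD : Set where
  field
    dom : ComputableIntegralDomain
  open ComputableIntegralDomain dom public
  field
    D       : ℕ → List ℕ
    D-spec  : ∀ a → InA a → ¬ (a ≡ zro) → ∀ d → (d ∈ D a) ⇔ (InA d × d ∣A a)

module Submission where

-- Since A is a domain, 1 ≠ 0, and the units of A are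
-- precisely the divisors of 1; hence the list D 1 enumerates U(A), which
-- proves part (1) and makes "is a unit" decidable.
--
-- For part (2), the only unbounded quantifier in "x is irreducible" is the
-- one over all factorizations x = a b.  For x ≠ 0 both factors of such a
-- factorization are divisors of x, so the quantifier may be restricted to
-- the finite list D x (lemma 'factorizations⇔divisorPairs').  A property of
-- factorizations that is decidable pointwise is therefore decidable for all
-- factorizations of x at once, and irreducibility is decided by checking
-- membership in A, x ≠ 0, x not a unit, and this bounded condition in turn.

open import Defs
open import Data.Nat using (ℕ)
import Data.Nat as ℕ
open import Data.Bool using (true)
import Data.Bool as Bool
open import Data.Product using (Σ; _×_; _,_; proj₁)
open import Data.Sum using (_⊎_)
open import Data.List using (List)
open import Data.List.Membership.Propositional using (_∈_)
open import Data.List.Membership.DecPropositional ℕ._≟_ using (_∈?_)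
open import Data.List.Relation.Unary.All using (All; all?; tabulate; lookup)
open import Relation.Nullary using (Dec; yes; no; ¬_)
open import Relation.Nullary.Decidable using (map′; _⊎-dec_; _→-dec_)
open import Relation.Binary.PropositionalEquality using (_≡_; trans)
open import Function.Bundles using (_⇔_; Equivalence; mk⇔)

module _ (A : SCFFD) where
  open SCFFD A
  open Equivalence

  unitsAreDivisorsOfOne : ∀ u → (u ∈ D one) ⇔ IsUnit u
  unitsAreDivisorsOfOne u = D-spec one one-in one≢zro u

  isUnit? : ∀ u → Dec (IsUnit u)
  isUnit? u = map′ (to (unitsAreDivisorsOfOne u)) (from (unitsAreDivisorsOfOne u))
                   (u ∈? D one)

  ForallFactorizations : (ℕ → ℕ → Set) → ℕ → Set
  ForallFactorizations P x = ∀ a b → InA a → InA b → mul a b ≡ x → P a b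

  ForallDivisorPairs : (ℕ → ℕ → Set) → ℕ → Set
  ForallDivisorPairs P x = All (λ a → All (λ b → mul a b ≡ x → P a b) (D x)) (D x)

  -- For nonzero x ∈ A both factors of any factorization of x divide x, and
  -- every listed divisor lies in A; so the two quantifications agree.
  factorizations⇔divisorPairs : ∀ (P : ℕ → ℕ → Set) x → InA x → ¬ (x ≡ zro) →
                                ForallFactorizations P x ⇔ ForallDivisorPairs P x
  factorizations⇔divisorPairs P x x∈A x≢0 = mk⇔ restrict extend
    where
    divisor : ∀ d → d ∈ D x ⇔ (InA d × d ∣A x)
    divisor = D-spec x x∈A x≢0

    restrict : ForallFactorizations P x → ForallDivisorPairs P x
    restrict all-fact = tabulate λ {a} a∈D → tabulate λ {b} b∈D →
      all-fact a b (proj₁ (to (divisor a) a∈D)) (proj₁ (to (divisor b) b∈D))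

    extend : ForallDivisorPairs P x → ForallFactorizations P x
    extend all-pairs a b a∈A b∈A ab≡x =
      lookup (lookup all-pairs (from (divisor a) (a∈A , b , b∈A , ab≡x)))
             (from (divisor b) (b∈A , a , a∈A , trans (mul-comm b∈A a∈A) ab≡x))
             ab≡x

  forallFactorizations? : ∀ {P : ℕ → ℕ → Set} → (∀ a b → Dec (P a b)) →
                          ∀ x → InA x → ¬ (x ≡ zro) → Dec (ForallFactorizations P x)
  forallFactorizations? {P} P? x x∈A x≢0 =
    map′ (from equiv) (to equiv)
         (all? (λ a → all? (λ b → (mul a b ℕ.≟ x) →-dec P? a b) (D x)) (D x))
    where
    equiv : ForallFactorizations P x ⇔ ForallDivisorPairs P x
    equiv = factorizations⇔divisorPairs P x x∈A x≢0

  irreducible? : ∀ x → Dec (Irreducible x)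
  irreducible? x with mem x Bool.≟ true
  ... | no x∉A = no λ { (x∈A , _) → x∉A x∈A }
  ... | yes x∈A with x ℕ.≟ zro
  ...   | yes x≡0 = no λ { (_ , x≢0 , _) → x≢0 x≡0 }
  ...   | no x≢0 with isUnit? x
  ...     | yes unit = no λ { (_ , _ , nonunit , _) → nonunit unit }
  ...     | no nonunit =
    map′ (λ factors → x∈A , x≢0 , nonunit , factors)
         (λ { (_ , _ , _ , factors) → factors })
         (forallFactorizations? (λ a b → isUnit? a ⊎-dec isUnit? b) x x∈A x≢0)

mainTheorem3 : (A : SCFFD) →
    (Σ (List ℕ) λ L → ∀ u → (u ∈ L) ⇔ SCFFD.IsUnit A u)
    × (∀ x → Dec (SCFFD.Irreducible A x))
mainTheorem3 A = (SCFFD.D A (SCFFD.one A) , unitsAreDivisorsOfOne A) , irreducible? A
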